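{- Let $G$ be a group admitting a normal subgroup $K$ and a subgroup $L$ such that $G=KL$ and $K\cap L=\{1\}$. Let $H\leq A\leq L$. Then $A$ is a total perfect code of $(G,H)$ if and only if $A$ is a total perfect code of $(L,H)$.
   Context: All groups are finite. For a group $G$, a subgroup $H\leq G$ and a subset $U\subseteq G$ which is a union of double cosets of $H$ with $H\cap U=\emptyset$ and $U^{ -1}=U$, the coset graph $\mathrm{Cos}(G,H,U)$ has as vertex set the set of left cosets of $H$ in $G$, with $g_1H$ and $g_2H$ adjacent iff $g_1^{ -1}g_2\in U$. A total perfect code in a graph is a set $C$ of vertices such that every vertex is adjacent to exactly one vertex of $C$. For $H\leq A\leq G$, $A$ is called a total perfect code of the pair $(G,H)$ if there is a coset graph $\mathrm{Cos}(G,H,U)$ in which the set $\{aH: a\in A\}$ of left cosets of $H$ contained in $A$ is a total perfect code. -}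

module Defs where

open import Data.Nat using (ℕ)
open import Data.Fin using (Fin)
open import Data.Fin.Subset using (Subset; _∈_; _⊆_; ⊤)
open import Data.Product using (Σ; ∃; _×_; _,_)
open import Data.Empty using (⊥)
open import Relation.Binary.PropositionalEquality using (_≡_)

-- A finite group, presented on the carrier Fin order
-- (every finite group is isomorphic to one of this form).
record FinGroup : Set where
  infixl 7 _·_
  field
    order : ℕ
    _·_   : Fin order → Fin order → Fin order
    e     : Fin order
    inv   : Fin order → Fin order
    assoc : ∀ x y z → (x · y) · z ≡ x · (y · z)
    idˡ   : ∀ x → e · x ≡ x
    idʳ   : ∀ x → x · e ≡ x
    invˡ  : ∀ x → inv x · x ≡ e
    invʳ  : ∀ x → x · inv x ≡ e

module _ (G : FinGroup) where
  open FinGroup G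

  Carrier : Set
  Carrier = Fin order

  SubsetG : Set
  SubsetG = Subset order

  IsSubgroup : SubsetG → Set
  IsSubgroup H = (e ∈ H)
               × (∀ x y → x ∈ H → y ∈ H → x · y ∈ H)
               × (∀ x → x ∈ H → inv x ∈ H)

  IsNormal : SubsetG → Set
  IsNormal K = ∀ g k → k ∈ K → g · k · inv g ∈ K

  IsProductKL : SubsetG → SubsetG → Set
  IsProductKL K L = ∀ g → Σ Carrier λ k → Σ Carrier λ l → k ∈ K × l ∈ L × g ≡ k · l

  TrivialIntersection : SubsetG → SubsetG → Set
  TrivialIntersection K L = ∀ x → x ∈ K → x ∈ L → x ≡ e

  -- Connection set of a coset graph Cos(X, H, U) of the group X (a subgroup of G):
  -- U ⊆ X, U a union of double cosets H u H, H ∩ U = ∅, U⁻¹ = U.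
  IsConnectionSet : (X H U : SubsetG) → Set
  IsConnectionSet X H U = (U ⊆ X)
                        × (∀ u h h′ → u ∈ U → h ∈ H → h′ ∈ H → h · u · h′ ∈ U)
                        × (∀ x → x ∈ H → x ∈ U → ⊥)
                        × (∀ u → u ∈ U → inv u ∈ U)

  -- In Cos(X, H, U), the set {aH : a ∈ A} is a total perfect code:
  -- every vertex gH (g ∈ X) is adjacent to exactly one vertex aH with a ∈ A,
  -- where gH ~ aH iff g⁻¹ a ∈ U, and aH = a′H iff a⁻¹ a′ ∈ H.
  IsTotalPerfectCodeIn : (X H U A : SubsetG) → Set
  IsTotalPerfectCodeIn X H U A =
      (∀ g → g ∈ X → Σ Carrier λ a → a ∈ A × inv g · a ∈ U)
    × (∀ g a a′ → g ∈ X → a ∈ A → a′ ∈ A → inv g · a ∈ U → inv g · a′ ∈ U → inv a · a′ ∈ H)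

  IsTPCOfPair : (X H A : SubsetG) → Set
  IsTPCOfPair X H A = Σ SubsetG λ U → IsConnectionSet X H U × IsTotalPerfectCodeIn X H U A

  whole : SubsetG
  whole = ⊤

-- A normal complement K of L makes the L-component of g = k l a retraction homomorphism
-- π : G → L.  A connection set U of a coset graph of L pulls back along π to a connection set
-- π⁻¹(U) of G, and since π(g⁻¹ a) = π(g)⁻¹ a for a ∈ A ⊆ L, the code conditions at g reduce to
-- those at π g.  Conversely a connection set U of G cuts down to U ∩ L for the subgroup L.
module Submission where

open import Algebra.Bundles using (Group)
open import Data.Empty using (⊥)
open import Data.Fin.Subset using (_∈_; _⊆_; _∩_)
open import Data.Fin.Subset.Properties using (∈⊤; x∈p∩q⁺; x∈p∩q⁻)
open import Data.Product using (Σ; _×_; _,_; proj₁; proj₂)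
open import Data.Vec using (tabulate; lookup)
open import Data.Vec.Properties using (lookup∘tabulate; []=⇒lookup; lookup⇒[]=)
open import Level using (0ℓ)
open import Relation.Binary.PropositionalEquality

open import Defs

module _ (G : FinGroup) where
  open FinGroup G

  group : Group 0ℓ 0ℓ
  group = record
    { _≈_ = _≡_ ; _∙_ = _·_ ; ε = e ; _⁻¹ = inv
    ; isGroup = record
      { isMonoid = record
        { isSemigroup = record
          { isMagma = record { isEquivalence = isEquivalence ; ∙-cong = cong₂ _·_ }
          ; assoc = assoc }
        ; identity = idˡ , idʳ }
      ; inverse = invˡ , invʳ
      ; ⁻¹-cong = cong inv } }

  open import Algebra.Properties.Group group
    using (quasigroup; \\-leftDividesʳ; //-rightDividesʳ; inverseˡ-unique; x∙y⁻¹≈ε⇒x≈y)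
  open import Algebra.Properties.Quasigroup quasigroup using (cancelˡ)

  module _ {X : SubsetG G} (X≤G : IsSubgroup G X) where

    e∈ : e ∈ X
    e∈ = proj₁ X≤G

    ·-closed : ∀ {x y} → x ∈ X → y ∈ X → x · y ∈ X
    ·-closed = proj₁ (proj₂ X≤G) _ _

    inv-closed : ∀ {x} → x ∈ X → inv x ∈ X
    inv-closed = proj₂ (proj₂ X≤G) _

  IsTPCOfPair-restrict : ∀ {X Y H A} → IsSubgroup G Y → Y ⊆ X → H ⊆ Y → A ⊆ Y
    → IsTPCOfPair G X H A → IsTPCOfPair G Y H A
  IsTPCOfPair-restrict {Y = Y} {H} {A} Y≤G Y⊆X H⊆Y A⊆Y (U , (_ , U-dbl , U-disj , U-inv) , (U-ex , U-un)) =
    U ∩ Y , (∩-⊆Y , ∩-dbl , ∩-disj , ∩-inv) , (∩-ex , ∩-un)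
    where
    ∈U : ∀ {u} → u ∈ U ∩ Y → u ∈ U
    ∈U u∈ = proj₁ (x∈p∩q⁻ U Y u∈)

    ∩-⊆Y : U ∩ Y ⊆ Y
    ∩-⊆Y u∈ = proj₂ (x∈p∩q⁻ U Y u∈)

    ∩-dbl : ∀ u h h′ → u ∈ U ∩ Y → h ∈ H → h′ ∈ H → h · u · h′ ∈ U ∩ Y
    ∩-dbl u h h′ u∈ h∈H h′∈H = x∈p∩q⁺
      (U-dbl u h h′ (∈U u∈) h∈H h′∈H , ·-closed Y≤G (·-closed Y≤G (H⊆Y h∈H) (∩-⊆Y u∈)) (H⊆Y h′∈H))

    ∩-disj : ∀ x → x ∈ H → x ∈ U ∩ Y → ⊥
    ∩-disj x x∈H x∈ = U-disj x x∈H (∈U x∈)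

    ∩-inv : ∀ u → u ∈ U ∩ Y → inv u ∈ U ∩ Y
    ∩-inv u u∈ = x∈p∩q⁺ (U-inv u (∈U u∈) , inv-closed Y≤G (∩-⊆Y u∈))

    ∩-ex : ∀ g → g ∈ Y → Σ (Carrier G) λ a → a ∈ A × inv g · a ∈ U ∩ Y
    ∩-ex g g∈Y with U-ex g (Y⊆X g∈Y)
    ... | a , a∈A , g⁻¹a∈U = a , a∈A , x∈p∩q⁺ (g⁻¹a∈U , ·-closed Y≤G (inv-closed Y≤G g∈Y) (A⊆Y a∈A))

    ∩-un : ∀ g a a′ → g ∈ Y → a ∈ A → a′ ∈ A → inv g · a ∈ U ∩ Y → inv g · a′ ∈ U ∩ Y → inv a · a′ ∈ H
    ∩-un g a a′ g∈Y a∈A a′∈A p q = U-un g a a′ (Y⊆X g∈Y) a∈A a′∈A (∈U p) (∈U q)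

  record IsRetractionOnto (L : SubsetG G) (π : Carrier G → Carrier G) : Set where
    field
      π-∈     : ∀ g → π g ∈ L
      π-fixes : ∀ {l} → l ∈ L → π l ≡ l
      π-homo  : ∀ x y → π (x · y) ≡ π x · π y

    π-e : π e ≡ e
    π-e = cancelˡ (π e) (π e) e (begin
      π e · π e ≡⟨ π-homo e e ⟨
      π (e · e) ≡⟨ cong π (idˡ e) ⟩
      π e       ≡⟨ idʳ (π e) ⟨
      π e · e   ∎)
      where open ≡-Reasoning

    π-inv : ∀ g → π (inv g) ≡ inv (π g)
    π-inv g = inverseˡ-unique (π (inv g)) (π g)
      (trans (sym (π-homo (inv g) g)) (trans (cong π (invˡ g)) π-e))

    π-inv· : ∀ g {a} → a ∈ L → π (inv g · a) ≡ inv (π g) · a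
    π-inv· g {a} a∈L = trans (π-homo (inv g) a) (cong₂ _·_ (π-inv g) (π-fixes a∈L))

    π-conjugate : ∀ {h h′} u → h ∈ L → h′ ∈ L → π (h · u · h′) ≡ h · π u · h′
    π-conjugate {h} {h′} u h∈L h′∈L = begin
      π (h · u · h′)      ≡⟨ π-homo (h · u) h′ ⟩
      π (h · u) · π h′    ≡⟨ cong₂ _·_ (π-homo h u) (π-fixes h′∈L) ⟩
      π h · π u · h′      ≡⟨ cong (λ x → x · π u · h′) (π-fixes h∈L) ⟩
      h · π u · h′        ∎
      where open ≡-Reasoning

  preimage : (Carrier G → Carrier G) → SubsetG G → SubsetG G
  preimage π U = tabulate (λ g → lookup U (π g))

  module _ {π : Carrier G → Carrier G} {U : SubsetG G} where

    ∈-preimage⁺ : ∀ {g} → π g ∈ U → g ∈ preimage π U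
    ∈-preimage⁺ {g} p = lookup⇒[]= g (preimage π U) (trans (lookup∘tabulate _ g) ([]=⇒lookup p))

    ∈-preimage⁻ : ∀ {g} → g ∈ preimage π U → π g ∈ U
    ∈-preimage⁻ {g} p =
      lookup⇒[]= (π g) U (trans (sym (lookup∘tabulate (λ x → lookup U (π x)) g)) ([]=⇒lookup p))

  IsTPCOfPair-lift : ∀ {L H A π} → IsRetractionOnto L π → H ⊆ L → A ⊆ L
    → IsTPCOfPair G L H A → IsTPCOfPair G (whole G) H A
  IsTPCOfPair-lift {L} {H} {A} {π} retr H⊆L A⊆L (U , (_ , U-dbl , U-disj , U-inv) , (U-ex , U-un)) =
    preimage π U , ((λ _ → ∈⊤) , π⁻¹U-dbl , π⁻¹U-disj , π⁻¹U-inv) , (π⁻¹U-ex , π⁻¹U-un)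
    where
    open IsRetractionOnto retr

    π⁻¹U-dbl : ∀ u h h′ → u ∈ preimage π U → h ∈ H → h′ ∈ H → h · u · h′ ∈ preimage π U
    π⁻¹U-dbl u h h′ u∈ h∈H h′∈H = ∈-preimage⁺ (subst (_∈ U)
      (sym (π-conjugate u (H⊆L h∈H) (H⊆L h′∈H))) (U-dbl (π u) h h′ (∈-preimage⁻ u∈) h∈H h′∈H))

    π⁻¹U-disj : ∀ x → x ∈ H → x ∈ preimage π U → ⊥
    π⁻¹U-disj x x∈H x∈ = U-disj x x∈H (subst (_∈ U) (π-fixes (H⊆L x∈H)) (∈-preimage⁻ x∈))

    π⁻¹U-inv : ∀ u → u ∈ preimage π U → inv u ∈ preimage π U
    π⁻¹U-inv u u∈ = ∈-preimage⁺ (subst (_∈ U) (sym (π-inv u)) (U-inv (π u) (∈-preimage⁻ u∈)))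

    π⁻¹U-ex : ∀ g → g ∈ whole G → Σ (Carrier G) λ a → a ∈ A × inv g · a ∈ preimage π U
    π⁻¹U-ex g _ with U-ex (π g) (π-∈ g)
    ... | a , a∈A , p = a , a∈A , ∈-preimage⁺ (subst (_∈ U) (sym (π-inv· g (A⊆L a∈A))) p)

    π⁻¹U-un : ∀ g a a′ → g ∈ whole G → a ∈ A → a′ ∈ A
      → inv g · a ∈ preimage π U → inv g · a′ ∈ preimage π U → inv a · a′ ∈ H
    π⁻¹U-un g a a′ _ a∈A a′∈A p q = U-un (π g) a a′ (π-∈ g) a∈A a′∈A
      (subst (_∈ U) (π-inv· g (A⊆L a∈A)) (∈-preimage⁻ p))
      (subst (_∈ U) (π-inv· g (A⊆L a′∈A)) (∈-preimage⁻ q))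

  module Complement {K L : SubsetG G} (K≤G : IsSubgroup G K) (K⊴G : IsNormal G K)
      (L≤G : IsSubgroup G L) (G=KL : IsProductKL G K L) (K∩L=1 : TrivialIntersection G K L) where
    open ≡-Reasoning

    ·-factor-unique : ∀ {k k′ l l′} → k ∈ K → k′ ∈ K → l ∈ L → l′ ∈ L → k · l ≡ k′ · l′ → l ≡ l′
    ·-factor-unique {k} {k′} {l} {l′} k∈K k′∈K l∈L l′∈L kl≡k′l′ =
      x∙y⁻¹≈ε⇒x≈y l l′ (K∩L=1 (l · inv l′) l·l′⁻¹∈K (·-closed L≤G l∈L (inv-closed L≤G l′∈L)))
      where
      k⁻¹k′≡l·l′⁻¹ : inv k · k′ ≡ l · inv l′
      k⁻¹k′≡l·l′⁻¹ = begin
        inv k · k′                 ≡⟨ cong (inv k ·_) (//-rightDividesʳ l′ k′) ⟨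
        inv k · (k′ · l′ · inv l′) ≡⟨ cong (λ x → inv k · (x · inv l′)) kl≡k′l′ ⟨
        inv k · (k · l · inv l′)   ≡⟨ cong (inv k ·_) (assoc k l (inv l′)) ⟩
        inv k · (k · (l · inv l′)) ≡⟨ \\-leftDividesʳ k (l · inv l′) ⟩
        l · inv l′                 ∎

      l·l′⁻¹∈K : l · inv l′ ∈ K
      l·l′⁻¹∈K = subst (_∈ K) k⁻¹k′≡l·l′⁻¹ (·-closed K≤G (inv-closed K≤G k∈K) k′∈K)

    L-component : Carrier G → Carrier G
    L-component g = proj₁ (proj₂ (G=KL g))

    L-component-unique : ∀ {g k l} → k ∈ K → l ∈ L → g ≡ k · l → L-component g ≡ l
    L-component-unique {g} k∈K l∈L g≡kl with G=KL g
    ... | k′ , l′ , k′∈K , l′∈L , g≡k′l′ = sym (·-factor-unique k∈K k′∈K l∈L l′∈L (trans (sym g≡kl) g≡k′l′))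

    -- x y = (k · l k′ l⁻¹) (l l′), whose first factor lies in K by normality.
    L-component-homo : ∀ x y → L-component (x · y) ≡ L-component x · L-component y
    L-component-homo x y with G=KL x | G=KL y
    ... | k , l , k∈K , l∈L , x≡kl | k′ , l′ , k′∈K , l′∈L , y≡k′l′ =
      L-component-unique (·-closed K≤G k∈K (K⊴G l k′ k′∈K)) (·-closed L≤G l∈L l′∈L) (begin
        x · y                             ≡⟨ cong₂ _·_ x≡kl y≡k′l′ ⟩
        k · l · (k′ · l′)                 ≡⟨ assoc k l (k′ · l′) ⟩
        k · (l · (k′ · l′))               ≡⟨ cong (k ·_) (assoc l k′ l′) ⟨
        k · (l · k′ · l′)                 ≡⟨ cong (λ z → k · (l · k′ · z)) (\\-leftDividesʳ l l′) ⟨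
        k · (l · k′ · (inv l · (l · l′))) ≡⟨ cong (k ·_) (assoc (l · k′) (inv l) (l · l′)) ⟨
        k · (l · k′ · inv l · (l · l′))   ≡⟨ assoc k (l · k′ · inv l) (l · l′) ⟨
        k · (l · k′ · inv l) · (l · l′)   ∎)

    L-component-isRetraction : IsRetractionOnto L L-component
    L-component-isRetraction = record
      { π-∈     = λ g → proj₁ (proj₂ (proj₂ (proj₂ (G=KL g))))
      ; π-fixes = λ {l} l∈L → L-component-unique (e∈ K≤G) l∈L (sym (idˡ l))
      ; π-homo  = L-component-homo
      }

theorem4p4 : (G : FinGroup) → (K L H A : SubsetG G)
    → IsSubgroup G K → IsNormal G K → IsSubgroup G L
    → IsProductKL G K L → TrivialIntersection G K L
    → IsSubgroup G H → IsSubgroup G A → H ⊆ A → A ⊆ L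
    → (IsTPCOfPair G (whole G) H A → IsTPCOfPair G L H A)
      × (IsTPCOfPair G L H A → IsTPCOfPair G (whole G) H A)
theorem4p4 G K L H A K≤G K⊴G L≤G G=KL K∩L=1 _ _ H⊆A A⊆L =
    IsTPCOfPair-restrict G L≤G (λ _ → ∈⊤) H⊆L A⊆L
  , IsTPCOfPair-lift G (Complement.L-component-isRetraction G K≤G K⊴G L≤G G=KL K∩L=1) H⊆L A⊆L
  where
  H⊆L : H ⊆ L
  H⊆L h∈H = A⊆L (H⊆A h∈H)
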